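{- Every minimal cycle in the transition graph of $\mathrm{SExp}$ is, up to cyclic rotation, of the form $(e*f)g_1\cdots g_l\to e_1(e*f)g_1\cdots g_l\to\cdots\to e_m(e*f)g_1\cdots g_l\to(e*f)g_1\cdots g_l$ for some $l\ge0$, $m\ge0$ and $e,f,e_1,\dots,e_m,g_1,\dots,g_l\in\mathrm{SExp}$, where sequential composition associates to the left.
   Context: Fix a finite set $A$. $\mathrm{SExp}$ is generated by $e,f::=a\in A\mid0\mid e+f\mid ef\mid e*f$, with outputs $e\Rightarrow a$ and labelled transitions $e\xrightarrow{a}f$ exactly those derivable by: $a\Rightarrow a$; if $e_i\Rightarrow a$ then $e_1+e_2\Rightarrow a$; if $e_i\xrightarrow{a}f$ then $e_1+e_2\xrightarrow{a}f$; if $e_1\Rightarrow a$ then $e_1e_2\xrightarrow{a}e_2$; if $e_1\xrightarrow{a}f$ then $e_1e_2\xrightarrow{a}fe_2$; if $e_2\Rightarrow a$ then $e_1*e_2\Rightarrow a$; if $e_2\xrightarrow{a}f$ then $e_1*e_2\xrightarrow{a}f$; if $e_1\xrightarrow{a}f$ then $e_1*e_2\xrightarrow{a}f(e_1*e_2)$; if $e_1\Rightarrow a$ then $e_1*e_2\xrightarrow{a}e_1*e_2$. Write $e\to f$ if $e\xrightarrow{a}f$ for some $a\in A$. A minimal cycle is a cycle $x_1\to x_2\to\cdots\to x_k\to x_1$ ($k\ge1$) with $x_1,\dots,x_k$ pairwise distinct. -}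

module Defs where

open import Data.Nat using (ℕ; suc)
open import Data.Fin using (Fin)
open import Data.Empty using (⊥)
open import Data.List using (List; []; _∷_; _++_; map; foldl; length)
open import Data.List.Relation.Unary.Unique.Propositional using (Unique)
open import Data.Product using (Σ; ∃; _×_; _,_)
open import Relation.Binary.PropositionalEquality using (_≡_)

module SExpDefs (n : ℕ) where

  A : Set
  A = Fin n

  infixl 7 _⊙_
  infixl 6 _⊕_
  infixl 8 _⊛_

  data SExp : Set where
    act : A → SExp
    𝟘   : SExp
    _⊕_ : SExp → SExp → SExp
    _⊙_ : SExp → SExp → SExp   -- sequential composition e f
    _⊛_ : SExp → SExp → SExp

  data _⇒_ : SExp → A → Set where
    out-act : ∀ {a} → act a ⇒ a
    out-+l  : ∀ {e₁ e₂ a} → e₁ ⇒ a → (e₁ ⊕ e₂) ⇒ a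
    out-+r  : ∀ {e₁ e₂ a} → e₂ ⇒ a → (e₁ ⊕ e₂) ⇒ a
    out-*   : ∀ {e₁ e₂ a} → e₂ ⇒ a → (e₁ ⊛ e₂) ⇒ a

  data _—[_]→_ : SExp → A → SExp → Set where
    tr-+l   : ∀ {e₁ e₂ a f} → e₁ —[ a ]→ f → (e₁ ⊕ e₂) —[ a ]→ f
    tr-+r   : ∀ {e₁ e₂ a f} → e₂ —[ a ]→ f → (e₁ ⊕ e₂) —[ a ]→ f
    tr-seq-out : ∀ {e₁ e₂ a} → e₁ ⇒ a → (e₁ ⊙ e₂) —[ a ]→ e₂
    tr-seq  : ∀ {e₁ e₂ a f} → e₁ —[ a ]→ f → (e₁ ⊙ e₂) —[ a ]→ (f ⊙ e₂)
    tr-*r   : ∀ {e₁ e₂ a f} → e₂ —[ a ]→ f → (e₁ ⊛ e₂) —[ a ]→ f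
    tr-*l   : ∀ {e₁ e₂ a f} → e₁ —[ a ]→ f → (e₁ ⊛ e₂) —[ a ]→ (f ⊙ (e₁ ⊛ e₂))
    tr-*out : ∀ {e₁ e₂ a} → e₁ ⇒ a → (e₁ ⊛ e₂) —[ a ]→ (e₁ ⊛ e₂)

  _⟶_ : SExp → SExp → Set
  e ⟶ f = ∃ λ a → e —[ a ]→ f

  data Chain : SExp → List SExp → SExp → Set where
    last : ∀ {x z} → x ⟶ z → Chain x [] z
    step : ∀ {x y ys z} → x ⟶ y → Chain y ys z → Chain x (y ∷ ys) z

  -- a minimal cycle x₁ ⟶ x₂ ⟶ ⋯ ⟶ xₖ ⟶ x₁ (k ≥ 1), listed as x₁ ∷ [x₂,…,xₖ],
  -- with x₁,…,xₖ pairwise distinct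
  MinimalCycle : List SExp → Set
  MinimalCycle []       = ⊥
  MinimalCycle (x ∷ xs) = Unique (x ∷ xs) × Chain x xs x

  IsRotation : List SExp → List SExp → Set
  IsRotation xs ys = ∃ λ us → ∃ λ vs → xs ≡ us ++ vs × ys ≡ vs ++ us

  seqL : SExp → List SExp → SExp
  seqL h gs = foldl _⊙_ h gs

  StarCycle : SExp → SExp → List SExp → List SExp → List SExp
  StarCycle e f es gs =
    seqL (e ⊛ f) gs ∷ map (λ eᵢ → seqL (eᵢ ⊙ (e ⊛ f)) gs) es

-- Every state reachable from x is a ⊙-product of subterms of x, so no cycle returns
-- to a sum x ⊕ y, nor to e * f after a step of f: neither is such a product of
-- strictly smaller terms. A cycle through e * f therefore leaves by e-steps through
-- states eᵢ(e * f) and closes when eᵢ terminates. A cycle through w g either keeps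
-- the form w′ g throughout, and is a cycle of w composed with g, or visits g, and
-- rotated to start at g it is a cycle of the smaller term g.
module Submission where

open import Defs
open import Data.Nat using (ℕ; suc; _+_; _≤_; _<_; s≤s)
open import Data.Nat.Properties using (≤-refl; ≤-trans; <⇒≤; <-irrefl; m≤m+n; m≤n+m)
open import Data.List using (List; []; _∷_; _++_; map; [_])
open import Data.List.Properties using (∷-injective; map-++; map-∘; map-cong; foldl-++; ++-assoc; ++-identityʳ)
open import Data.List.Membership.Propositional.Properties using (∈-++⁺ʳ)
open import Data.List.Relation.Unary.Any using (here)
open import Data.List.Relation.Unary.Unique.Propositional.Properties using (Unique[x∷xs]⇒x∉xs; map⁻)
open import Data.Product using (∃; ∃₂; _×_; _,_)
open import Data.Sum using (_⊎_; inj₁; inj₂)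
open import Data.Empty using (⊥-elim)
open import Relation.Binary.PropositionalEquality using (_≡_; refl; sym; cong; cong₂; subst; setoid; module ≡-Reasoning)
open import Relation.Nullary using (¬_)

module MinimalCycles (n : ℕ) where
  open SExpDefs n
  open import Data.List.Relation.Binary.Permutation.Setoid.Properties (setoid SExp)
    using (Unique-resp-↭; ++-comm)

  size : SExp → ℕ
  size (act _) = 1
  size 𝟘       = 1
  size (x ⊕ y) = suc (size x + size y)
  size (x ⊙ y) = suc (size x + size y)
  size (x ⊛ y) = suc (size x + size y)

  size-argˡ : ∀ x y → size x < suc (size x + size y)
  size-argˡ x y = s≤s (m≤m+n (size x) (size y))

  size-argʳ : ∀ x y → size y < suc (size x + size y)
  size-argʳ x y = s≤s (m≤n+m (size y) (size x))

  infix 4 _⊑_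

  data _⊑_ : SExp → SExp → Set where
    ⊑-refl : ∀ {x} → x ⊑ x
    ⊕ˡ : ∀ {x y z} → x ⊑ y → x ⊑ y ⊕ z
    ⊕ʳ : ∀ {x y z} → x ⊑ z → x ⊑ y ⊕ z
    ⊙ˡ : ∀ {x y z} → x ⊑ y → x ⊑ y ⊙ z
    ⊙ʳ : ∀ {x y z} → x ⊑ z → x ⊑ y ⊙ z
    ⊛ˡ : ∀ {x y z} → x ⊑ y → x ⊑ y ⊛ z
    ⊛ʳ : ∀ {x y z} → x ⊑ z → x ⊑ y ⊛ z

  ⊑-trans : ∀ {x y z} → x ⊑ y → y ⊑ z → x ⊑ z
  ⊑-trans p ⊑-refl = p
  ⊑-trans p (⊕ˡ q) = ⊕ˡ (⊑-trans p q)
  ⊑-trans p (⊕ʳ q) = ⊕ʳ (⊑-trans p q)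
  ⊑-trans p (⊙ˡ q) = ⊙ˡ (⊑-trans p q)
  ⊑-trans p (⊙ʳ q) = ⊙ʳ (⊑-trans p q)
  ⊑-trans p (⊛ˡ q) = ⊛ˡ (⊑-trans p q)
  ⊑-trans p (⊛ʳ q) = ⊛ʳ (⊑-trans p q)

  ⊑⇒size≤ : ∀ {x y} → x ⊑ y → size x ≤ size y
  ⊑⇒size≤ ⊑-refl             = ≤-refl
  ⊑⇒size≤ (⊕ˡ {y = y} {z} p) = ≤-trans (⊑⇒size≤ p) (<⇒≤ (size-argˡ y z))
  ⊑⇒size≤ (⊕ʳ {y = y} {z} p) = ≤-trans (⊑⇒size≤ p) (<⇒≤ (size-argʳ y z))
  ⊑⇒size≤ (⊙ˡ {y = y} {z} p) = ≤-trans (⊑⇒size≤ p) (<⇒≤ (size-argˡ y z))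
  ⊑⇒size≤ (⊙ʳ {y = y} {z} p) = ≤-trans (⊑⇒size≤ p) (<⇒≤ (size-argʳ y z))
  ⊑⇒size≤ (⊛ˡ {y = y} {z} p) = ≤-trans (⊑⇒size≤ p) (<⇒≤ (size-argˡ y z))
  ⊑⇒size≤ (⊛ʳ {y = y} {z} p) = ≤-trans (⊑⇒size≤ p) (<⇒≤ (size-argʳ y z))

  data Closure (x : SExp) : SExp → Set where
    subterm : ∀ {w} → w ⊑ x → Closure x w
    _⊙_     : ∀ {w₁ w₂} → Closure x w₁ → Closure x w₂ → Closure x (w₁ ⊙ w₂)

  closure-mono : ∀ {x y w} → x ⊑ y → Closure x w → Closure y w
  closure-mono p (subterm q) = subterm (⊑-trans q p)
  closure-mono p (c₁ ⊙ c₂)   = closure-mono p c₁ ⊙ closure-mono p c₂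

  closure-⊑ : ∀ {x u w} → u ⊑ w → Closure x w → Closure x u
  closure-⊑ p      (subterm q) = subterm (⊑-trans p q)
  closure-⊑ ⊑-refl c           = c
  closure-⊑ (⊙ˡ p) (c₁ ⊙ c₂)   = closure-⊑ p c₁
  closure-⊑ (⊙ʳ p) (c₁ ⊙ c₂)   = closure-⊑ p c₂

  closure-trans : ∀ {x w z} → Closure x w → Closure w z → Closure x z
  closure-trans c (subterm p) = closure-⊑ p c
  closure-trans c (d₁ ⊙ d₂)   = closure-trans c d₁ ⊙ closure-trans c d₂

  closure-larger⇒⊙ : ∀ {x w} → Closure x w → size x < size w → ∃₂ λ u v → w ≡ u ⊙ v
  closure-larger⇒⊙ (subterm p) x<w = ⊥-elim (<-irrefl refl (≤-trans x<w (⊑⇒size≤ p)))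
  closure-larger⇒⊙ (_⊙_ {w₁} {w₂} _ _) _ = w₁ , w₂ , refl

  —→⇒closure : ∀ {x a w} → x —[ a ]→ w → Closure x w
  —→⇒closure (tr-+l t)      = closure-mono (⊕ˡ ⊑-refl) (—→⇒closure t)
  —→⇒closure (tr-+r t)      = closure-mono (⊕ʳ ⊑-refl) (—→⇒closure t)
  —→⇒closure (tr-seq-out _) = subterm (⊙ʳ ⊑-refl)
  —→⇒closure (tr-seq t)     = closure-mono (⊙ˡ ⊑-refl) (—→⇒closure t) ⊙ subterm (⊙ʳ ⊑-refl)
  —→⇒closure (tr-*r t)      = closure-mono (⊛ʳ ⊑-refl) (—→⇒closure t)
  —→⇒closure (tr-*l t)      = closure-mono (⊛ˡ ⊑-refl) (—→⇒closure t) ⊙ subterm ⊑-refl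
  —→⇒closure (tr-*out _)    = subterm ⊑-refl

  closure-step : ∀ {x w a w′} → Closure x w → w —[ a ]→ w′ → Closure x w′
  closure-step (subterm p) t              = closure-mono p (—→⇒closure t)
  closure-step (c₁ ⊙ c₂)   (tr-seq-out _) = c₂
  closure-step (c₁ ⊙ c₂)   (tr-seq t)     = closure-step c₁ t ⊙ c₂

  chain⇒closure : ∀ {x ys z} → Chain x ys z → Closure x z
  chain⇒closure = go (subterm ⊑-refl)
    where
      go : ∀ {x w ys z} → Closure x w → Chain w ys z → Closure x z
      go c (last (_ , t))    = closure-step c t
      go c (step (_ , t) ch) = go (closure-step c t) ch

  chain-first-step : ∀ {x ys z} → Chain x ys z → ∃₂ λ a w → x —[ a ]→ w × Closure w z
  chain-first-step (last (a , t))    = a , _ , t , subterm ⊑-refl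
  chain-first-step (step (a , t) ch) = a , _ , t , chain⇒closure ch

  ⊕-acyclic : ∀ {x y ys} → ¬ Chain (x ⊕ y) ys (x ⊕ y)
  ⊕-acyclic {x} {y} ch with chain-first-step ch
  ... | _ , _ , tr-+l t , c
        with () ← closure-larger⇒⊙ (closure-trans (—→⇒closure t) c) (size-argˡ x y)
  ... | _ , _ , tr-+r t , c
        with () ← closure-larger⇒⊙ (closure-trans (—→⇒closure t) c) (size-argʳ x y)

  chain-split : ∀ {x ys y zs z} → Chain x (ys ++ y ∷ zs) z → Chain x ys y × Chain y zs z
  chain-split {ys = []}     (step t ch) = last t , ch
  chain-split {ys = _ ∷ ys} (step t ch) with chain-split {ys = ys} ch
  ... | ch₁ , ch₂ = step t ch₁ , ch₂

  chain-join : ∀ {x ys y zs z} → Chain x ys y → Chain y zs z → Chain x (ys ++ y ∷ zs) z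
  chain-join (last t)     ch = step t ch
  chain-join (step t ch₁) ch = step t (chain-join ch₁ ch)

  minimalCycle-rotate : ∀ {x ps y qs} → MinimalCycle (x ∷ ps ++ y ∷ qs) → MinimalCycle (y ∷ qs ++ x ∷ ps)
  minimalCycle-rotate {x} {ps} {y} {qs} (u , ch) with chain-split {ys = ps} ch
  ... | ch₁ , ch₂ = Unique-resp-↭ (++-comm (x ∷ ps) (y ∷ qs)) u , chain-join ch₂ ch₁

  data ⊙-Path (w g : SExp) : List SExp → SExp → Set where
    inside  : ∀ {ws v} → Chain w ws v → ⊙-Path w g (map (_⊙ g) ws) (v ⊙ g)
    exits   : ∀ ws → ⊙-Path w g (map (_⊙ g) ws) g
    through : ∀ ps qs {z} → ⊙-Path w g (ps ++ g ∷ qs) z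

  ⊙-path : ∀ {w g ys z} → Chain (w ⊙ g) ys z → ⊙-Path w g ys z
  ⊙-path (last (_ , tr-seq-out _))             = exits []
  ⊙-path (last (a , tr-seq t))                 = inside (last (a , t))
  ⊙-path (step {ys = ys} (_ , tr-seq-out _) _) = through [] ys
  ⊙-path (step {y = w₁ ⊙ g} (a , tr-seq t) ch) with ⊙-path ch
  ... | inside c      = inside (step (a , t) c)
  ... | exits ws      = exits (w₁ ∷ ws)
  ... | through ps qs = through (w₁ ⊙ g ∷ ps) qs

  ⊛-cycle : ∀ {e f xs} → MinimalCycle (e ⊛ f ∷ xs) → ∃ λ es → xs ≡ map (_⊙ (e ⊛ f)) es
  ⊛-cycle (_ , last _) = [] , refl
  ⊛-cycle {e} {f} (_ , step (_ , tr-*r t) ch)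
    with () ← closure-larger⇒⊙ (closure-trans (—→⇒closure t) (chain⇒closure ch)) (size-argʳ e f)
  ⊛-cycle (u , step (_ , tr-*out _) _) = ⊥-elim (Unique[x∷xs]⇒x∉xs u (here refl))
  ⊛-cycle (u , step {y = e′ ⊙ _} (_ , tr-*l t) ch) with ⊙-path ch
  ... | exits es      = e′ ∷ es , refl
  ... | through ps qs = ⊥-elim (Unique[x∷xs]⇒x∉xs u (∈-++⁺ʳ (_ ∷ ps) (here refl)))

  rotation-refl : ∀ xs → IsRotation xs xs
  rotation-refl xs = xs , [] , sym (++-identityʳ xs) , refl

  private
    ++-cases : ∀ (as bs cs ds : List SExp) → as ++ bs ≡ cs ++ ds →
      (∃ λ ms → cs ≡ as ++ ms × bs ≡ ms ++ ds) ⊎ (∃ λ ms → as ≡ cs ++ ms × ds ≡ ms ++ bs)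
    ++-cases []       bs cs       ds eq   = inj₁ (cs , refl , eq)
    ++-cases (a ∷ as) bs []       ds eq   = inj₂ (a ∷ as , refl , sym eq)
    ++-cases (a ∷ as) bs (c ∷ cs) ds eq with ∷-injective eq
    ... | refl , eq′ with ++-cases as bs cs ds eq′
    ... | inj₁ (ms , p , q) = inj₁ (ms , cong (a ∷_) p , q)
    ... | inj₂ (ms , p , q) = inj₂ (ms , cong (a ∷_) p , q)

  rotation-trans : ∀ {xs ys zs} → IsRotation xs ys → IsRotation ys zs → IsRotation xs zs
  rotation-trans (us , vs , refl , refl) (us′ , vs′ , eq , refl) with ++-cases vs us us′ vs′ eq
  ... | inj₁ (ms , refl , refl) = ms , vs′ ++ vs , ++-assoc ms vs′ vs , sym (++-assoc vs′ vs ms)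
  ... | inj₂ (ms , refl , refl) = us ++ us′ , ms , sym (++-assoc us us′ ms) , ++-assoc ms us us′

  rotation-map : ∀ (h : SExp → SExp) {xs ys} → IsRotation xs ys → IsRotation (map h xs) (map h ys)
  rotation-map h (us , vs , refl , refl) = map h us , map h vs , map-++ h us vs , map-++ h vs us

  seqL-snoc : ∀ h gs g → seqL h gs ⊙ g ≡ seqL h (gs ++ [ g ])
  seqL-snoc h gs g = sym (foldl-++ _⊙_ h gs [ g ])

  map-⊙-StarCycle : ∀ e f es gs g → map (_⊙ g) (StarCycle e f es gs) ≡ StarCycle e f es (gs ++ [ g ])
  map-⊙-StarCycle e f es gs g = cong₂ _∷_ (seqL-snoc (e ⊛ f) gs g) (begin
    map (_⊙ g) (map (λ eᵢ → seqL (eᵢ ⊙ (e ⊛ f)) gs) es)   ≡⟨ sym (map-∘ es) ⟩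
    map (λ eᵢ → seqL (eᵢ ⊙ (e ⊛ f)) gs ⊙ g) es            ≡⟨ map-cong (λ eᵢ → seqL-snoc (eᵢ ⊙ (e ⊛ f)) gs g) es ⟩
    map (λ eᵢ → seqL (eᵢ ⊙ (e ⊛ f)) (gs ++ [ g ])) es     ∎)
    where open ≡-Reasoning

  IsRotatedStarCycle : List SExp → Set
  IsRotatedStarCycle xs = ∃ λ e → ∃ λ f → ∃ λ (es : List SExp) → ∃ λ (gs : List SExp) →
    IsRotation xs (StarCycle e f es gs)

  minimalCycle-shape : ∀ x xs → MinimalCycle (x ∷ xs) → IsRotatedStarCycle (x ∷ xs)
  minimalCycle-shape (act _) xs (_ , ch) with chain-first-step ch
  ... | _ , _ , () , _
  minimalCycle-shape 𝟘 xs (_ , ch) with chain-first-step ch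
  ... | _ , _ , () , _
  minimalCycle-shape (x ⊕ y) xs (_ , ch) = ⊥-elim (⊕-acyclic ch)
  minimalCycle-shape (e ⊛ f) xs c with ⊛-cycle c
  ... | es , refl = e , f , es , [] , rotation-refl _
  -- exits is impossible here: it would make g ≡ w ⊙ g.
  minimalCycle-shape (w ⊙ g) xs (u , ch) with ⊙-path ch
  ... | inside {ws} c
        with e , f , es , gs , r ← minimalCycle-shape w ws (map⁻ u , c)
        = e , f , es , gs ++ [ g ] ,
          subst (IsRotation (map (_⊙ g) (w ∷ ws))) (map-⊙-StarCycle e f es gs g) (rotation-map (_⊙ g) r)
  ... | through ps qs
        with e , f , es , gs , r ← minimalCycle-shape g (qs ++ w ⊙ g ∷ ps) (minimalCycle-rotate (u , ch))
        = e , f , es , gs , rotation-trans (w ⊙ g ∷ ps , g ∷ qs , refl , refl) r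

lemmaC2 : (n : ℕ) → let open SExpDefs n in
          (xs : List SExp) → MinimalCycle xs →
          ∃ λ e → ∃ λ f → ∃ λ (es : List SExp) → ∃ λ (gs : List SExp) →
            IsRotation xs (StarCycle e f es gs)
lemmaC2 n []       ()
lemmaC2 n (x ∷ xs) = MinimalCycles.minimalCycle-shape n x xs
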